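{- Let $k,x,b$ be positive integers and let $a$ be a nonnegative integer such that $k=a+b$. Assume that $x\ge a$. Then \[\binom{2k}{k}\le\binom{2a}{a}\binom{x+2b}{b}.\] Moreover, equality holds if and only if $x=a=1$. -}

module Defs where

-- Passing from b to b + 1 multiplies C(2k,k) by
-- (2k+2)(2k+1)/(k+1)² and C(2a,a)·C(a+2b,b) by (b+k+2)(b+k+1)/((b+1)(k+1)), and
--   (b+k+2)(b+k+1)·(k+1)² − (2k+2)(2k+1)·(b+1)(k+1) = a(a−1)·(k+1)².
-- As both sides agree at b = 0, induction on b gives the inequality for x = a, with equality
-- for a = 1 and strict inequality for a ≥ 2 and b ≥ 1. Since C(x+2b,b) increases strictly
-- with x, this settles x ≥ a; the case a = 0 is that strict monotonicity alone.
module Submission where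

open import Defs
open import Data.Nat using (ℕ; _+_; _*_; _≤_; _<_)
open import Data.Nat.Combinatorics using (_C_)
open import Data.Product using (_×_)
open import Relation.Binary.PropositionalEquality using (_≡_)
open import Function.Bundles using (_⇔_)

open import Data.Nat
  using (zero; suc; _∸_; _!; _≤′_; ≤′-refl; ≤′-step; NonZero; >-nonZero; ≢-nonZero⁻¹; z<s; s<s)
open import Data.Nat.Properties
open import Data.Nat.Combinatorics using (nCk+nC[k+1]≡[n+1]C[k+1]; k![n∸k]!∣n!)
open import Data.Nat.Combinatorics.Specification using (nCk≡n!/k![n-k]!)
open import Data.Nat.DivMod using (_/_; m/n*n≡m)
open import Data.Nat.Tactic.RingSolver using (solve-∀)
open import Algebra.Properties.CommutativeSemigroup *-commutativeSemigroup
  using (xy∙z≈xz∙y; x∙yz≈y∙xz)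
open import Data.Product using (_,_)
open import Data.Sum using (_⊎_; inj₁; inj₂)
open import Function.Bundles using (mk⇔)
open import Relation.Nullary using (¬_; contradiction)
open import Relation.Binary.PropositionalEquality
  using (refl; sym; trans; cong; cong₂; module ≡-Reasoning)

[n+m]Cn*[n!*m!]≡[n+m]! : ∀ n m → ((n + m) C n) * (n ! * m !) ≡ (n + m) !
[n+m]Cn*[n!*m!]≡[n+m]! n m = begin
  ((n + m) C n) * (n ! * m !)  ≡⟨ cong (λ j → ((n + m) C n) * (n ! * j !)) (m+n∸m≡n n m) ⟨
  ((n + m) C n) * d            ≡⟨ cong (_* d) (nCk≡n!/k![n-k]! (m≤m+n n m)) ⟩
  (n + m) ! / d * d            ≡⟨ m/n*n≡m (k![n∸k]!∣n! (m≤m+n n m)) ⟩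
  (n + m) !                    ∎
  where
  open ≡-Reasoning
  d = n ! * (n + m ∸ n) !
  instance _ = n !* (n + m ∸ n) !≢0

[n+m]Cn>0 : ∀ n m → 0 < (n + m) C n
[n+m]Cn>0 n m = n≢0⇒n>0 λ C≡0 → ≢-nonZero⁻¹ _ {{(n + m) !≢0}}
  (trans (sym ([n+m]Cn*[n!*m!]≡[n+m]! n m)) (cong (_* (n ! * m !)) C≡0))

[n+m]Cn-diagonal-step : ∀ n m → ((suc n + suc m) C suc n) * (suc n * suc m)
                         ≡ (suc (suc (n + m)) * suc (n + m)) * ((n + m) C n)
[n+m]Cn-diagonal-step n m = *-cancelʳ-≡ _ _ (n ! * m !) {{n !* m !≢0}} (begin
  ((suc n + suc m) C suc n) * (suc n * suc m) * (n ! * m !)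
    ≡⟨ rearrange ((suc n + suc m) C suc n) (suc n) (suc m) (n !) (m !) ⟩
  ((suc n + suc m) C suc n) * (suc n ! * suc m !)
    ≡⟨ [n+m]Cn*[n!*m!]≡[n+m]! (suc n) (suc m) ⟩
  suc (n + suc m) !
    ≡⟨ cong (λ j → suc j !) (+-suc n m) ⟩
  suc (suc (n + m)) * (suc (n + m) * (n + m) !)
    ≡⟨ *-assoc (suc (suc (n + m))) (suc (n + m)) ((n + m) !) ⟨
  A * (n + m) !
    ≡⟨ cong (A *_) ([n+m]Cn*[n!*m!]≡[n+m]! n m) ⟨
  A * (((n + m) C n) * (n ! * m !))
    ≡⟨ *-assoc A ((n + m) C n) (n ! * m !) ⟨
  A * ((n + m) C n) * (n ! * m !) ∎)
  where
  open ≡-Reasoning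
  A = suc (suc (n + m)) * suc (n + m)
  rearrange : ∀ x p q f g → x * (p * q) * (f * g) ≡ x * ((p * f) * (q * g))
  rearrange = solve-∀

[1+n+1+m]C[1+n]≡[n+1+m]Cn+[1+n+m]C[1+n] : ∀ n m →
  (suc n + suc m) C suc n ≡ (n + suc m) C n + (suc n + m) C suc n
[1+n+1+m]C[1+n]≡[n+1+m]Cn+[1+n+m]C[1+n] n m = begin
  (suc n + suc m) C suc n                  ≡⟨ nCk+nC[k+1]≡[n+1]C[k+1] (n + suc m) n ⟨
  (n + suc m) C n + (n + suc m) C suc n    ≡⟨ cong (λ j → (n + suc m) C n + j C suc n) (+-suc n m) ⟩
  (n + suc m) C n + (suc n + m) C suc n    ∎
  where open ≡-Reasoning

[1+n+m]C[1+n]<[1+n+1+m]C[1+n] : ∀ n m → (suc n + m) C suc n < (suc n + suc m) C suc n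
[1+n+m]C[1+n]<[1+n+1+m]C[1+n] n m = <-≤-trans (m<n+m _ ([n+m]Cn>0 n (suc m)))
  (≤-reflexive (sym ([1+n+1+m]C[1+n]≡[n+1+m]Cn+[1+n+m]C[1+n] n m)))

[n+m]Cn≤[n+1+m]Cn : ∀ n m → (n + m) C n ≤ (n + suc m) C n
[n+m]Cn≤[n+1+m]Cn zero    m = ≤-refl
[n+m]Cn≤[n+1+m]Cn (suc n) m = <⇒≤ ([1+n+m]C[1+n]<[1+n+1+m]C[1+n] n m)

[n+m]Cn-monoʳ-≤ : ∀ n {m m′} → m ≤ m′ → (n + m) C n ≤ (n + m′) C n
[n+m]Cn-monoʳ-≤ n m≤m′ = mono (≤⇒≤′ m≤m′)
  where
  mono : ∀ {m m′} → m ≤′ m′ → (n + m) C n ≤ (n + m′) C n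
  mono ≤′-refl      = ≤-refl
  mono (≤′-step le) = ≤-trans (mono le) ([n+m]Cn≤[n+1+m]Cn n _)

[1+n+m]C[1+n]-monoʳ-< : ∀ n {m m′} → m < m′ → (suc n + m) C suc n < (suc n + m′) C suc n
[1+n+m]C[1+n]-monoʳ-< n {m} m<m′ =
  <-≤-trans ([1+n+m]C[1+n]<[1+n+1+m]C[1+n] n m) ([n+m]Cn-monoʳ-≤ (suc n) m<m′)

scale-step : ∀ X X′ A u v → X′ * u ≡ A * X → X′ * (u * v) ≡ (A * v) * X
scale-step X X′ A u v e = begin
  X′ * (u * v)  ≡⟨ *-assoc X′ u v ⟨
  X′ * u * v    ≡⟨ cong (_* v) e ⟩
  A * X * v     ≡⟨ xy∙z≈xz∙y A X v ⟩
  A * v * X     ∎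
  where open ≡-Reasoning

scale-step-under : ∀ R R′ B P u v → R′ * v ≡ B * R → (B * u) * (P * R) ≡ P * R′ * (u * v)
scale-step-under R R′ B P u v e = begin
  (B * u) * (P * R)   ≡⟨ x∙yz≈y∙xz (B * u) P R ⟩
  P * ((B * u) * R)   ≡⟨ cong (P *_) (scale-step R R′ B v u e) ⟨
  P * (R′ * (v * u))  ≡⟨ cong (λ w → P * (R′ * w)) (*-comm v u) ⟩
  P * (R′ * (u * v))  ≡⟨ *-assoc P R′ (u * v) ⟨
  P * R′ * (u * v)    ∎
  where open ≡-Reasoning

-- L′/L = A/u and R′/R = B/v, so A/u ≤ B/v carries L ≤ P·R over to L′ ≤ P·R′.
module ByRatios (L L′ R R′ P A B u v : ℕ) .{{_ : NonZero (u * v)}}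
                (L-step : L′ * u ≡ A * L) (R-step : R′ * v ≡ B * R) where

  ≤-by-ratios : A * v ≤ B * u → L ≤ P * R → L′ ≤ P * R′
  ≤-by-ratios Av≤Bu L≤PR = *-cancelʳ-≤ L′ (P * R′) (u * v) (begin
    L′ * (u * v)       ≡⟨ scale-step L L′ A u v L-step ⟩
    (A * v) * L        ≤⟨ *-mono-≤ Av≤Bu L≤PR ⟩
    (B * u) * (P * R)  ≡⟨ scale-step-under R R′ B P u v R-step ⟩
    P * R′ * (u * v)   ∎)
    where open ≤-Reasoning

  <-by-ratios : A * v < B * u → 0 < L → L ≤ P * R → L′ < P * R′
  <-by-ratios Av<Bu L>0 L≤PR = *-cancelʳ-< (u * v) L′ (P * R′) (begin-strict
    L′ * (u * v)       ≡⟨ scale-step L L′ A u v L-step ⟩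
    (A * v) * L        <⟨ *-monoˡ-< L {{>-nonZero L>0}} Av<Bu ⟩
    (B * u) * L        ≤⟨ *-monoʳ-≤ (B * u) L≤PR ⟩
    (B * u) * (P * R)  ≡⟨ scale-step-under R R′ B P u v R-step ⟩
    P * R′ * (u * v)   ∎)
    where open ≤-Reasoning

  ≡-by-ratios : A * v ≡ B * u → L ≡ P * R → L′ ≡ P * R′
  ≡-by-ratios Av≡Bu L≡PR = *-cancelʳ-≡ L′ (P * R′) (u * v) (begin
    L′ * (u * v)       ≡⟨ scale-step L L′ A u v L-step ⟩
    (A * v) * L        ≡⟨ cong₂ _*_ Av≡Bu L≡PR ⟩
    (B * u) * (P * R)  ≡⟨ scale-step-under R R′ B P u v R-step ⟩
    P * R′ * (u * v)   ∎)
    where open ≡-Reasoning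

central-ratio-gap : ∀ c b → let a = suc c; k = b + a in
  (suc (suc (b + k)) * suc (b + k)) * (suc k * suc k)
    ≡ (suc (suc (k + k)) * suc (k + k)) * (suc b * suc k) + (a * c) * (suc k * suc k)
central-ratio-gap = solve-∀

-- k is written b + a so that its value at suc b is definitionally suc k.
module CentralStep (a b : ℕ) where
  k = b + a
  open ByRatios ((k + k) C k) ((suc k + suc k) C suc k) ((b + k) C b) ((suc b + suc k) C suc b)
                ((a + a) C a) (suc (suc (k + k)) * suc (k + k)) (suc (suc (b + k)) * suc (b + k))
                (suc k * suc k) (suc b * suc k)
                ([n+m]Cn-diagonal-step k k) ([n+m]Cn-diagonal-step b k) public

central-≤ : ∀ c b → let a = suc c; k = b + a in
  (k + k) C k ≤ ((a + a) C a) * ((b + k) C b)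
central-≤ c zero    = ≤-reflexive (sym (*-identityʳ _))
central-≤ c (suc b) =
  ≤-by-ratios (≤-trans (m≤m+n _ _) (≤-reflexive (sym (central-ratio-gap c b)))) (central-≤ c b)
  where open CentralStep (suc c) b

central-< : ∀ c b → let a = suc (suc c); k = suc b + a in
  (k + k) C k < ((a + a) C a) * ((suc b + k) C suc b)
central-< c b =
  <-by-ratios (<-≤-trans (m<m+n _ z<s) (≤-reflexive (sym (central-ratio-gap (suc c) b))))
              ([n+m]Cn>0 k k) (central-≤ (suc c) b)
  where open CentralStep (suc (suc c)) b

central-≡ : ∀ b → let k = b + 1 in
  (k + k) C k ≡ ((1 + 1) C 1) * ((b + k) C b)
central-≡ zero    = refl
central-≡ (suc b) = ≡-by-ratios (sym (trans (central-ratio-gap 0 b) (+-identityʳ _))) (central-≡ b)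
  where open CentralStep 1 b

StrictUnless : Set → ℕ → ℕ → Set
StrictUnless Q m n = (Q × m ≡ n) ⊎ (¬ Q × m < n)

StrictUnless⇒≤×[≡⇔] : ∀ {Q m n} → StrictUnless Q m n → m ≤ n × (m ≡ n ⇔ Q)
StrictUnless⇒≤×[≡⇔] (inj₁ (q , refl))  = ≤-refl , mk⇔ (λ _ → q) (λ _ → refl)
StrictUnless⇒≤×[≡⇔] (inj₂ (¬q , m<n)) =
  <⇒≤ m<n , mk⇔ (λ m≡n → contradiction m≡n (<⇒≢ m<n)) (λ q → contradiction q ¬q)

central-comparison : ∀ x b a → 0 < x → 0 < b → a ≤ x → let k = b + a in
  StrictUnless (x ≡ 1 × a ≡ 1) ((k + k) C k) (((a + a) C a) * ((b + (b + x)) C b))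
central-comparison (suc x) (suc b) zero _ _ _ = inj₂ ((λ { (_ , ()) }) , (begin-strict
  (suc b + 0 + (suc b + 0)) C (suc b + 0)  ≡⟨ cong (λ j → (j + j) C j) (+-identityʳ (suc b)) ⟩
  (suc b + suc b) C suc b                   <⟨ [1+n+m]C[1+n]-monoʳ-< b (m<m+n (suc b) z<s) ⟩
  (suc b + (suc b + suc x)) C suc b         ≡⟨ *-identityˡ _ ⟨
  1 * ((suc b + (suc b + suc x)) C suc b)   ∎))
  where open ≤-Reasoning
central-comparison (suc zero) b (suc zero) _ _ _ = inj₁ ((refl , refl) , central-≡ b)
central-comparison (suc (suc x)) (suc b) (suc zero) _ _ _ = inj₂ ((λ { (() , _) }) , (begin-strict
  (k + k) C k
    ≡⟨ central-≡ (suc b) ⟩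
  2 * ((suc b + (suc b + 1)) C suc b)
    <⟨ *-monoʳ-< 2 ([1+n+m]C[1+n]-monoʳ-< b (+-monoʳ-< (suc b) (s<s z<s))) ⟩
  2 * ((suc b + (suc b + suc (suc x))) C suc b)
    ∎))
  where
  open ≤-Reasoning
  k = suc b + 1
central-comparison x (suc b) (suc (suc c)) _ _ a≤x = inj₂ ((λ { (_ , ()) }) ,
  <-≤-trans (central-< c b)
            (*-monoʳ-≤ ((a + a) C a) ([n+m]Cn-monoʳ-≤ (suc b) (+-monoʳ-≤ (suc b) a≤x))))
  where a = suc (suc c)

2*n≡n+n : ∀ n → 2 * n ≡ n + n
2*n≡n+n n = cong (n +_) (+-identityʳ n)

x+2*b≡b+[b+x] : ∀ x b → x + 2 * b ≡ b + (b + x)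
x+2*b≡b+[b+x] = solve-∀

proposition2p1 : (k x b a : ℕ) → 0 < k → 0 < x → 0 < b → k ≡ a + b → a ≤ x →
    ((2 * k) C k ≤ ((2 * a) C a) * ((x + 2 * b) C b))
    × (((2 * k) C k ≡ ((2 * a) C a) * ((x + 2 * b) C b)) ⇔ (x ≡ 1 × a ≡ 1))
proposition2p1 .(a + b) x b a _ 0<x 0<b refl a≤x
  rewrite +-comm a b | 2*n≡n+n (b + a) | 2*n≡n+n a | x+2*b≡b+[b+x] x b
  = StrictUnless⇒≤×[≡⇔] (central-comparison x b a 0<x 0<b a≤x)
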